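{- Let $p$ be a pattern with $|p|\geq 2$ such that every sub-pattern of $p$ is convergent or reducible. Let $A$ be a $\Delta^0_2$ infinite set such that both $A$ and $\overline{A}$ are hyperimmune, and let $f:[\mathbb{N}]^2\to 2$ be a computable coloring which is a $\Delta^0_2$ approximation of $A$ (i.e. $\lim_y f(x,y)=A(x)$ for every $x$). Then for every infinite set $H$ such that $A$ and $\overline{A}$ are both $H$-hyperimmune, the pattern $p$ strongly $f$-appears in $H$.
   Context: A pattern is a function $p:[\ell]^2\to 2$, $\ell=|p|\geq1$, on unordered pairs from $\{0,\dots,\ell-1\}$; write $p(x,y)$ for $x<y$. For $\ell\ge2$, $p^-$ is the restriction of $p$ to $[\ell-1]^2$. A set $\{x_0<\dots<x_{k-1}\}$ $f$-realizes a pattern $q$ of length $k$ if $f(x_i,x_j)=q(i,j)$ for all $i<j<k$. A finite set $F=\{x_0<\dots<x_{\ell-2}\}$ strongly $f$-realizes $p$ if $F$ $f$-realizes $p^-$ and for every $i<\ell-1$, $f(x_i,y)=p(i,\ell-1)$ for all but finitely many $y$; $p$ strongly $f$-appears in $H$ if some finite $F\subseteq H$ strongly $f$-realizes $p$. Sub-pattern: $q$ is a sub-pattern of $p$ if there is an injective $g:\{0,\dots,|q|-1\}\to\{0,\dots,|p|-1\}$ with $q(x,y)=p(g(x),g(y))$ for all distinct $x,y$. Join: $p\uplus q$ has length $|p|+|q|-1$, with $(p\uplus q)(x,y)=p(x,y)$ if $y<|p|$; $=q(x-|p|+1,y-|p|+1)$ if $x\ge|p|-1$; $=p(x,|p|-1)$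 if $x<|p|-1<y$. A pattern is reducible if it equals $p\uplus q$ with $|p|,|q|\ge2$. A pattern of length $\ell$ is convergent if $x\mapsto p(x,\ell-1)$ is constant on $\{0,\dots,\ell-2\}$. A set $B$ is $X$-hyperimmune if it is infinite and for every $X$-computable sequence $\langle F_n\rangle$ of non-empty finite sets (given by canonical codes) with $\min F_n>n$, some $F_n$ is disjoint from $B$. -}

module Defs where

open import Data.Nat using (ℕ; zero; suc; _+_; _∸_; _^_; _≤_; _<_)
open import Data.Nat.DivMod using (_/_; _%_)
open import Data.Bool using (Bool; true; false; not; if_then_else_)
open import Data.Fin using (Fin)
open import Data.Vec using (Vec; []; _∷_; lookup)
open import Data.Product using (Σ; ∃; _×_; _,_)
open import Data.Sum using (_⊎_)
open import Relation.Binary.PropositionalEquality using (_≡_; _≢_)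
open import Relation.Nullary using (¬_)

Set′ : Set
Set′ = ℕ → Bool

Infinite : Set′ → Set
Infinite B = ∀ n → ∃ λ m → n ≤ m × B m ≡ true

complement : Set′ → Set′
complement B x = not (B x)

data PR : ℕ → Set where
  zer    : ∀ {n} → PR n
  succ   : PR 1
  proj   : ∀ {n} → Fin n → PR n
  oracle : PR 1
  comp   : ∀ {m n} → PR m → Vec (PR n) m → PR n
  prec   : ∀ {n} → PR n → PR (suc (suc n)) → PR (suc n)
  mu     : ∀ {n} → PR (suc n) → PR n

b2n : Bool → ℕ
b2n true  = 1
b2n false = 0

mutual
  data Eval (X : Set′) : ∀ {n} → PR n → Vec ℕ n → ℕ → Set where
    ev-zer    : ∀ {n} {xs : Vec ℕ n} → Eval X zer xs 0
    ev-succ   : ∀ {x} → Eval X succ (x ∷ []) (suc x)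
    ev-proj   : ∀ {n} {i : Fin n} {xs} → Eval X (proj i) xs (lookup xs i)
    ev-oracle : ∀ {x} → Eval X oracle (x ∷ []) (b2n (X x))
    ev-comp   : ∀ {m n} {g : PR m} {hs : Vec (PR n) m} {xs ys v} →
                EvalAll X xs hs ys → Eval X g ys v → Eval X (comp g hs) xs v
    ev-prec-z : ∀ {n} {g : PR n} {h xs v} →
                Eval X g xs v → Eval X (prec g h) (0 ∷ xs) v
    ev-prec-s : ∀ {n} {g : PR n} {h xs k r v} →
                Eval X (prec g h) (k ∷ xs) r → Eval X h (k ∷ r ∷ xs) v →
                Eval X (prec g h) (suc k ∷ xs) v
    ev-mu     : ∀ {n} {g : PR (suc n)} {xs y} →
                Eval X g (y ∷ xs) 0 →
                (∀ z → z < y → Σ ℕ λ w → Eval X g (z ∷ xs) (suc w)) →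
                Eval X (mu g) xs y

  data EvalAll (X : Set′) {n} (xs : Vec ℕ n) : ∀ {m} → Vec (PR n) m → Vec ℕ m → Set where
    []  : EvalAll X xs [] []
    _∷_ : ∀ {m h v} {hs : Vec (PR n) m} {vs} →
          Eval X h xs v → EvalAll X xs hs vs → EvalAll X xs (h ∷ hs) (v ∷ vs)

-- The empty oracle (for unrelativised computability).
∅ : Set′
∅ _ = false

Computable₁ : Set′ → (ℕ → ℕ) → Set
Computable₁ X g = ∃ λ (e : PR 1) → ∀ n → Eval X e (n ∷ []) (g n)

ComputableColoring : (ℕ → ℕ → Bool) → Set
ComputableColoring f =
  ∃ λ (e : PR 2) → ∀ x y → x < y → Eval ∅ e (x ∷ y ∷ []) (b2n (f x y))

-- Canonical codes of finite sets: i ∈ D_k iff bit i of k is 1.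

bit : ℕ → ℕ → ℕ
bit zero    k = k % 2
bit (suc i) k = bit i (k / 2)

_∈D_ : ℕ → ℕ → Set
i ∈D k = bit i k ≡ 1

Hyperimmune : Set′ → Set′ → Set
Hyperimmune X B =
  Infinite B ×
  (∀ (g : ℕ → ℕ) → Computable₁ X g →
     (∀ n → ∃ λ i → i ∈D g n) →
     (∀ n i → i ∈D g n → n < i) →
     ∃ λ n → ∀ i → i ∈D g n → B i ≡ false)

Approximates : (ℕ → ℕ → Bool) → Set′ → Set
Approximates f A = ∀ x → ∃ λ N → ∀ y → N < y → x < y → f x y ≡ A x

-- Patterns: a length ℓ ≥ 1 and a colouring p(x,y) for x < y < ℓ
-- (values outside this range are irrelevant).

record Pattern : Set where
  constructor pat
  field
    len : ℕ
    col : ℕ → ℕ → Bool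
open Pattern public

colU : Pattern → ℕ → ℕ → Bool
colU p a b with a Data.Nat.<ᵇ b
... | true  = col p a b
... | false = col p b a

_≈P_ : Pattern → Pattern → Set
p ≈P q = len p ≡ len q × (∀ x y → x < y → y < len p → col p x y ≡ col q x y)

SubPattern : Pattern → Pattern → Set
SubPattern q p = ∃ λ (g : ℕ → ℕ) →
  (∀ x → x < len q → g x < len p) ×
  (∀ x y → x < len q → y < len q → g x ≡ g y → x ≡ y) ×
  (∀ x y → x < y → y < len q → col q x y ≡ colU p (g x) (g y))

join : Pattern → Pattern → Pattern
join p q = pat (len p + len q ∸ 1) c
  where
  a = len p
  c : ℕ → ℕ → Bool
  c x y with y Data.Nat.<ᵇ a | (a ∸ 1) Data.Nat.≤ᵇ x
  ... | true  | _     = col p x y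
  ... | false | true  = col q (x ∸ (a ∸ 1)) (y ∸ (a ∸ 1))
  ... | false | false = col p x (a ∸ 1)

Reducible : Pattern → Set
Reducible r = ∃ λ p → ∃ λ q → 2 ≤ len p × 2 ≤ len q × r ≈P join p q

Convergent : Pattern → Set
Convergent p = ∀ x y → x < len p ∸ 1 → y < len p ∸ 1 →
  col p x (len p ∸ 1) ≡ col p y (len p ∸ 1)

StronglyRealizes : (ℕ → ℕ → Bool) → (ℕ → ℕ) → Pattern → Set
StronglyRealizes f xs p =
  (∀ i j → i < j → j < len p ∸ 1 → xs i < xs j) ×
  (∀ i j → i < j → j < len p ∸ 1 → f (xs i) (xs j) ≡ col p i j) ×
  (∀ i → i < len p ∸ 1 → ∃ λ N → ∀ y → N < y → xs i < y →
       f (xs i) y ≡ col p i (len p ∸ 1))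

StronglyAppears : (ℕ → ℕ → Bool) → Pattern → Set′ → Set
StronglyAppears f p H = ∃ λ (xs : ℕ → ℕ) →
  (∀ i → i < len p ∸ 1 → H (xs i) ≡ true) × StronglyRealizes f xs p

module Submission where

-- By well-founded induction on |p| we show that p strongly appears in H above every bound t.
--
-- If p = q ⊎ r is reducible, strongly realize q above t, then r above a point beyond which
-- every element of the q-part has settled on its limit colour; together they strongly realize p.
--
-- If p is convergent with limit colour c, the induction hypothesis for p⁻ together with one
-- more element of H yields realizations of p⁻ inside H above every t.  Searching for them is
-- H-computable, so for every k we can compute an interval F_k above k containing such a
-- realization.  As {x | A x ≢ c} is H-hyperimmune, some F_k misses it; the realization found
-- in that F_k consists of points x with A x ≡ c, that is lim_y f x y ≡ c, so it strongly
-- realizes p.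

open import Data.Bool using (Bool; true; false; not; _∧_; _∨_; if_then_else_)
open import Data.Bool.Properties using (∨-zeroʳ; T-≡; not-injective)
open import Data.Fin using (Fin; zero; suc)
open import Data.Nat
  using (ℕ; zero; suc; pred; _+_; _*_; _∸_; _⊔_; _≤_; _<_; _<ᵇ_; _≤ᵇ_; _<?_; z≤n; s≤s; z<s)
open import Data.Nat.DivMod using (_%_; m*n%n≡0; m*n/n≡m; [m+kn]%n≡m%n; +-distrib-/)
open import Data.Nat.Induction using (<-wellFounded)
open import Data.Nat.Properties
open import Data.Product using (Σ; ∃; _×_; _,_; proj₁; proj₂)
open import Data.Sum using (_⊎_; inj₁; inj₂)
open import Data.Vec using (Vec; []; _∷_; lookup; tabulate; head)
open import Data.Vec.Properties using (tabulate∘lookup)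
open import Function.Base using (id; case_of_)
open import Function.Bundles using (Equivalence)
open import Induction.WellFounded using (module All)
import Relation.Binary.Construct.On as On
open import Relation.Binary.Definitions using (tri<; tri≈; tri>)
open import Relation.Binary.PropositionalEquality
open import Relation.Nullary using (contradiction; yes; no)

open import Defs

<ᵇ≡true⇒< : ∀ {x y} → (x <ᵇ y) ≡ true → x < y
<ᵇ≡true⇒< {x} {y} x<ᵇy = <ᵇ⇒< x y (Equivalence.from T-≡ x<ᵇy)

<ᵇ-true : ∀ {x y} → x < y → (x <ᵇ y) ≡ true
<ᵇ-true x<y = Equivalence.to T-≡ (<⇒<ᵇ x<y)

<ᵇ-false : ∀ {x y} → y ≤ x → (x <ᵇ y) ≡ false
<ᵇ-false {x} {y} y≤x with x <ᵇ y in x<ᵇy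
... | false = refl
... | true  = contradiction (<ᵇ≡true⇒< x<ᵇy) (≤⇒≯ y≤x)

≤ᵇ-true : ∀ {x y} → x ≤ y → (x ≤ᵇ y) ≡ true
≤ᵇ-true x≤y = Equivalence.to T-≡ (≤⇒≤ᵇ x≤y)

≤ᵇ-false : ∀ {x y} → y < x → (x ≤ᵇ y) ≡ false
≤ᵇ-false {x} {y} y<x with x ≤ᵇ y in x≤ᵇy
... | false = refl
... | true  = contradiction (≤ᵇ⇒≤ x y (Equivalence.from T-≡ x≤ᵇy)) (<⇒≱ y<x)

∧≡true⁻ : ∀ {a b} → a ∧ b ≡ true → a ≡ true × b ≡ true
∧≡true⁻ {true} {true} _ = refl , refl

b2n-not≡0 : ∀ {a} → b2n (not a) ≡ 0 → a ≡ true
b2n-not≡0 {true} _ = refl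

agrees : Bool → Bool → Bool
agrees true  b = b
agrees false b = not b

agrees⇒≡ : ∀ c b → agrees c b ≡ true → b ≡ c
agrees⇒≡ true  true  _ = refl
agrees⇒≡ false false _ = refl

agrees-refl : ∀ c → agrees c c ≡ true
agrees-refl true  = refl
agrees-refl false = refl

splice : ℕ → (ℕ → ℕ) → (ℕ → ℕ) → ℕ → ℕ
splice k g h i = if i <ᵇ k then g i else h i

splice-< : ∀ k g h {i} → i < k → splice k g h i ≡ g i
splice-< k g h i<k rewrite <ᵇ-true i<k = refl

splice-≥ : ∀ k g h {i} → k ≤ i → splice k g h i ≡ h i
splice-≥ k g h k≤i rewrite <ᵇ-false k≤i = refl

Increasing : ℕ → (ℕ → ℕ) → Set
Increasing k zs = ∀ i → suc i < k → zs i < zs (suc i)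

Increasing⇒< : ∀ {k zs} → Increasing k zs → ∀ {i j} → i < j → j < k → zs i < zs j
Increasing⇒< {k} {zs} inc {i} {suc j} i<1+j 1+j<k with m<1+n⇒m<n∨m≡n i<1+j
... | inj₁ i<j  = <-trans (Increasing⇒< inc i<j (<-trans (n<1+n j) 1+j<k)) (inc j 1+j<k)
... | inj₂ refl = inc i 1+j<k

ChainBelow : ℕ → (ℕ → ℕ) → ℕ → Set
ChainBelow k zs b = Increasing k zs × (∀ i → suc i ≡ k → zs i < b)

ChainBelow⇒< : ∀ {k zs b} → ChainBelow k zs b → ∀ {i} → i < k → zs i < b
ChainBelow⇒< {suc k} (inc , last<b) {i} i<1+k with m<1+n⇒m<n∨m≡n i<1+k
... | inj₁ i<k  = <-trans (Increasing⇒< inc i<k (n<1+n k)) (last<b k refl)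
... | inj₂ refl = last<b i refl

Increasing⇒ChainBelow : ∀ {k zs} → Increasing k zs → ∃ (ChainBelow k zs)
Increasing⇒ChainBelow {zero}       increasing = 0 , increasing , λ _ ()
Increasing⇒ChainBelow {suc k} {zs} increasing = suc (zs k) , increasing , λ { i refl → ≤-refl }

Eventually : (ℕ → Set) → Set
Eventually P = ∃ λ N → ∀ y → N < y → P y

eventually-all : ∀ k {P : ℕ → ℕ → Set} → (∀ i → i < k → Eventually (P i)) →
                 Eventually (λ y → ∀ i → i < k → P i y)
eventually-all zero    _  = 0 , λ _ _ _ ()
eventually-all (suc k) ev with eventually-all k (λ i i<k → ev i (m<n⇒m<1+n i<k)) | ev k (n<1+n k)
... | N , below-k | M , at-k = N ⊔ M , λ y N⊔M<y i i<1+k → case m<1+n⇒m<n∨m≡n i<1+k of λ where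
  (inj₁ i<k)  → below-k y (≤-<-trans (m≤m⊔n N M) N⊔M<y) i i<k
  (inj₂ refl) → at-k y (≤-<-trans (m≤n⊔m N M) N⊔M<y)

firstZero : (ℕ → ℕ) → ℕ → ℕ
firstZero g zero = 0
firstZero g (suc w) with g (firstZero g w)
... | zero  = firstZero g w
... | suc _ = suc w

Positive : ℕ → Set
Positive v = ∃ λ u → v ≡ suc u

firstZero-invariant : ∀ g w → (∀ z → z < firstZero g w → Positive (g z)) ×
                               (g (firstZero g w) ≡ 0 ⊎ firstZero g w ≡ w)
firstZero-invariant g zero = (λ _ ()) , inj₂ refl
firstZero-invariant g (suc w) with g (firstZero g w) in eq | firstZero-invariant g w
... | zero  | before , _          = before , inj₁ eq
... | suc v | before , inj₂ at-w  = before′ , inj₂ refl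
  where
  before′ : ∀ z → z < suc w → Positive (g z)
  before′ z z<1+w with m<1+n⇒m<n∨m≡n z<1+w
  ... | inj₁ z<w  = before z (subst (z <_) (sym at-w) z<w)
  ... | inj₂ refl = v , trans (cong g (sym at-w)) eq

firstZero-before : ∀ g w z → z < firstZero g w → Positive (g z)
firstZero-before g w = proj₁ (firstZero-invariant g w)

firstZero-zero : ∀ g w → g w ≡ 0 → g (firstZero g w) ≡ 0
firstZero-zero g w gw≡0 with proj₂ (firstZero-invariant g w)
... | inj₁ found = found
... | inj₂ at-w  = trans (cong g at-w) gw≡0

anyBelow : ℕ → (ℕ → Bool) → Bool
anyBelow zero    Q = false
anyBelow (suc y) Q = anyBelow y Q ∨ Q y

anyBelow-elim : ∀ y Q → anyBelow y Q ≡ true → ∃ λ x → x < y × Q x ≡ true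
anyBelow-elim (suc y) Q any with anyBelow y Q in earlier
... | true  = let (x , x<y , Qx) = anyBelow-elim y Q earlier in x , m<n⇒m<1+n x<y , Qx
... | false = y , n<1+n y , any

anyBelow-intro : ∀ {y x} Q → x < y → Q x ≡ true → anyBelow y Q ≡ true
anyBelow-intro {suc y} {x} Q x<1+y Qx with m<1+n⇒m<n∨m≡n x<1+y
... | inj₁ x<y  = cong (_∨ Q y) (anyBelow-intro Q x<y Qx)
... | inj₂ refl = trans (cong (anyBelow x Q ∨_) Qx) (∨-zeroʳ _)

allBelow : ℕ → (ℕ → Bool) → Bool
allBelow zero    Q = true
allBelow (suc k) Q = allBelow k Q ∧ Q k

allBelow-elim : ∀ k Q → allBelow k Q ≡ true → ∀ i → i < k → Q i ≡ true
allBelow-elim (suc k) Q all i i<1+k with allBelow k Q in earlier | Q k in last | m<1+n⇒m<n∨m≡n i<1+k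
... | true | true | inj₁ i<k  = allBelow-elim k Q earlier i i<k
... | true | true | inj₂ refl = last

allBelow-intro : ∀ k Q → (∀ i → i < k → Q i ≡ true) → allBelow k Q ≡ true
allBelow-intro zero    Q all = refl
allBelow-intro (suc k) Q all =
  cong₂ _∧_ (allBelow-intro k Q (λ i i<k → all i (m<n⇒m<1+n i<k))) (all k (n<1+n k))

index : ∀ {n} → Vec ℕ n → ℕ → ℕ
index []       i       = 0
index (x ∷ xs) zero    = x
index (x ∷ xs) (suc i) = index xs i

-- k ⊕ d ≡ k + d, by the recursion that matches pushing k values onto a context of length d.
_⊕_ : ℕ → ℕ → ℕ
zero  ⊕ d = d
suc k ⊕ d = k ⊕ suc d

prepend : ∀ k {d} → (ℕ → ℕ) → Vec ℕ d → Vec ℕ (k ⊕ d)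
prepend zero    zs ctx = ctx
prepend (suc k) zs ctx = prepend k zs (zs k ∷ ctx)

index-prepend-≥ : ∀ k {d} zs (ctx : Vec ℕ d) j → index (prepend k zs ctx) (k + j) ≡ index ctx j
index-prepend-≥ zero    zs ctx j = refl
index-prepend-≥ (suc k) zs ctx j =
  trans (cong (index (prepend k zs (zs k ∷ ctx))) (sym (+-suc k j))) (index-prepend-≥ k zs (zs k ∷ ctx) (suc j))

index-prepend-< : ∀ k {d} zs (ctx : Vec ℕ d) {i} → i < k → index (prepend k zs ctx) i ≡ zs i
index-prepend-< (suc k) zs ctx {i} i<1+k with m<1+n⇒m<n∨m≡n i<1+k
... | inj₁ i<k  = index-prepend-< k zs (zs k ∷ ctx) i<k
... | inj₂ refl =
  trans (cong (index (prepend i zs (zs i ∷ ctx))) (sym (+-identityʳ i))) (index-prepend-≥ i zs (zs i ∷ ctx) 0)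

prepend-cong : ∀ k {d} {zs zs′} (ctx : Vec ℕ d) → (∀ i → i < k → zs i ≡ zs′ i) →
               prepend k zs ctx ≡ prepend k zs′ ctx
prepend-cong zero    ctx eq = refl
prepend-cong (suc k) ctx eq rewrite eq k (n<1+n k) =
  prepend-cong k _ (λ i i<k → eq i (m<n⇒m<1+n i<k))

anyChainBelow : ∀ k {d} → (Vec ℕ (k ⊕ suc d) → Bool) → Vec ℕ (suc d) → Bool
anyChainBelow zero    P ctx = P ctx
anyChainBelow (suc k) P ctx = anyBelow (head ctx) (λ x → anyChainBelow k P (x ∷ ctx))

anyChainBelow-elim : ∀ k {d} P (ctx : Vec ℕ (suc d)) → anyChainBelow k P ctx ≡ true →
                     ∃ λ zs → ChainBelow k zs (head ctx) × P (prepend k zs ctx) ≡ true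
anyChainBelow-elim zero    P ctx found = (λ _ → 0) , ((λ _ ()) , (λ _ ())) , found
anyChainBelow-elim (suc k) P ctx found
  with anyBelow-elim (head ctx) (λ x → anyChainBelow k P (x ∷ ctx)) found
... | x , x<b , found-x with anyChainBelow-elim k P (x ∷ ctx) found-x
... | zs , (inc , last<x) , Pzs = zs′ , (inc′ , last′<b) , Pzs′
  where
  zs′ = splice k zs (λ _ → x)
  zs′-< : ∀ {i} → i < k → zs′ i ≡ zs i
  zs′-< = splice-< k zs (λ _ → x)
  zs′-k : zs′ k ≡ x
  zs′-k = splice-≥ k zs (λ _ → x) ≤-refl
  Pzs′ : P (prepend k zs′ (zs′ k ∷ ctx)) ≡ true
  Pzs′ rewrite zs′-k | prepend-cong k (x ∷ ctx) (λ i → zs′-<) = Pzs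
  inc′ : Increasing (suc k) zs′
  inc′ i (s≤s 1+i≤k) with m≤n⇒m<n∨m≡n 1+i≤k
  ... | inj₁ 1+i<k  rewrite zs′-< (<-trans (n<1+n i) 1+i<k) | zs′-< 1+i<k = inc i 1+i<k
  ... | inj₂ refl rewrite zs′-< (n<1+n i) | zs′-k = last<x i refl
  last′<b : ∀ i → suc i ≡ suc k → zs′ i < head ctx
  last′<b i refl rewrite zs′-k = x<b

anyChainBelow-intro : ∀ k {d} P (ctx : Vec ℕ (suc d)) zs → ChainBelow k zs (head ctx) →
                      P (prepend k zs ctx) ≡ true → anyChainBelow k P ctx ≡ true
anyChainBelow-intro zero    P ctx zs _               Pzs = Pzs
anyChainBelow-intro (suc k) P ctx zs (inc , last<b) Pzs =
  anyBelow-intro (λ x → anyChainBelow k P (x ∷ ctx)) (last<b k refl)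
    (anyChainBelow-intro k P (zs k ∷ ctx) zs
       ((λ i 1+i<k → inc i (m<n⇒m<1+n 1+i<k)) , (λ { i refl → inc i ≤-refl })) Pzs)

ones : ℕ → ℕ
ones zero    = 0
ones (suc l) = suc (ones l * 2)

intervalCode : ℕ → ℕ → ℕ
intervalCode zero     len = ones len
intervalCode (suc lo) len = intervalCode lo len * 2

bit-zero-even : ∀ r → bit 0 (r * 2) ≡ 0
bit-zero-even r = m*n%n≡0 r 2

bit-suc-even : ∀ i r → bit (suc i) (r * 2) ≡ bit i r
bit-suc-even i r = cong (bit i) (m*n/n≡m r 2)

bit-zero-odd : ∀ r → bit 0 (suc (r * 2)) ≡ 1
bit-zero-odd r = [m+kn]%n≡m%n 1 r 2

bit-suc-odd : ∀ i r → bit (suc i) (suc (r * 2)) ≡ bit i r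
bit-suc-odd i r = cong (bit i) (trans (+-distrib-/ 1 (r * 2) no-carry) (m*n/n≡m r 2))
  where
  no-carry : 1 % 2 + (r * 2) % 2 < 2
  no-carry = subst (λ v → 1 % 2 + v < 2) (sym (m*n%n≡0 r 2)) (s≤s (s≤s z≤n))

∈-ones : ∀ {i l} → i < l → i ∈D ones l
∈-ones {zero}  {suc l} _         = bit-zero-odd (ones l)
∈-ones {suc i} {suc l} (s≤s i<l) = trans (bit-suc-odd i (ones l)) (∈-ones i<l)

∈-intervalCode : ∀ lo len {i} → lo ≤ i → i < lo + len → i ∈D intervalCode lo len
∈-intervalCode zero     len         _         i<len = ∈-ones i<len
∈-intervalCode (suc lo) len {suc i} (s≤s lo≤i) (s≤s i<) =
  trans (bit-suc-even i (intervalCode lo len)) (∈-intervalCode lo len lo≤i i<)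

intervalCode-min : ∀ lo len {i} → i ∈D intervalCode lo len → lo ≤ i
intervalCode-min zero     len         _   = z≤n
intervalCode-min (suc lo) len {zero}  i∈ =
  contradiction (trans (sym (bit-zero-even (intervalCode lo len))) i∈) 0≢1+n
intervalCode-min (suc lo) len {suc i} i∈ =
  s≤s (intervalCode-min lo len (trans (sym (bit-suc-even i (intervalCode lo len))) i∈))

-- Computability relative to an oracle

-- Under the empty oracle every query answers 0, so replacing queries by the constant 0
-- gives a program that behaves the same under any oracle.
mutual
  dropOracle : ∀ {n} → PR n → PR n
  dropOracle zer         = zer
  dropOracle succ        = succ
  dropOracle (proj i)    = proj i
  dropOracle oracle      = zer
  dropOracle (comp g hs) = comp (dropOracle g) (dropOracles hs)
  dropOracle (prec g h)  = prec (dropOracle g) (dropOracle h)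
  dropOracle (mu g)      = mu (dropOracle g)

  dropOracles : ∀ {n m} → Vec (PR n) m → Vec (PR n) m
  dropOracles []       = []
  dropOracles (h ∷ hs) = dropOracle h ∷ dropOracles hs

mutual
  dropOracle-eval : ∀ {X n} {e : PR n} {xs v} → Eval ∅ e xs v → Eval X (dropOracle e) xs v
  dropOracle-eval ev-zer             = ev-zer
  dropOracle-eval ev-succ            = ev-succ
  dropOracle-eval ev-proj            = ev-proj
  dropOracle-eval ev-oracle          = ev-zer
  dropOracle-eval (ev-comp hs g)     = ev-comp (dropOracles-eval hs) (dropOracle-eval g)
  dropOracle-eval (ev-prec-z g)      = ev-prec-z (dropOracle-eval g)
  dropOracle-eval (ev-prec-s rec h)  = ev-prec-s (dropOracle-eval rec) (dropOracle-eval h)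
  dropOracle-eval (ev-mu g earlier)  =
    ev-mu (dropOracle-eval g) λ z z<y → proj₁ (earlier z z<y) , dropOracle-eval (proj₂ (earlier z z<y))

  dropOracles-eval : ∀ {X n m} {xs : Vec ℕ n} {hs : Vec (PR n) m} {vs} →
                     EvalAll ∅ xs hs vs → EvalAll X xs (dropOracles hs) vs
  dropOracles-eval []       = []
  dropOracles-eval (h ∷ hs) = dropOracle-eval h ∷ dropOracles-eval hs

sg : ℕ → ℕ
sg v = 1 ∸ (1 ∸ v)

b2n-not : ∀ a → 1 ∸ b2n a ≡ b2n (not a)
b2n-not true  = refl
b2n-not false = refl

b2n-∧ : ∀ a b → b2n a + b2n b ∸ 1 ≡ b2n (a ∧ b)
b2n-∧ true  b     = refl
b2n-∧ false true  = refl
b2n-∧ false false = refl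

b2n-∨ : ∀ a b → sg (b2n a + b2n b) ≡ b2n (a ∨ b)
b2n-∨ true  true  = refl
b2n-∨ true  false = refl
b2n-∨ false true  = refl
b2n-∨ false false = refl

b2n-<ᵇ : ∀ x y → sg (y ∸ x) ≡ b2n (x <ᵇ y)
b2n-<ᵇ zero    zero    = refl
b2n-<ᵇ zero    (suc y) = cong (1 ∸_) (0∸n≡0 y)
b2n-<ᵇ (suc x) zero    = refl
b2n-<ᵇ (suc x) (suc y) = b2n-<ᵇ x y

uncurry₂ : {A : Set} → (ℕ → ℕ → A) → Vec ℕ 2 → A
uncurry₂ g (x ∷ y ∷ []) = g x y

-- A computable colouring is only specified on x < y, so f is evaluated at max y (x + 1).
guarded : (ℕ → ℕ → Bool) → ℕ → ℕ → Bool
guarded f x y = f x (suc x + (y ∸ suc x))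

guarded-< : ∀ f {x y} → x < y → guarded f x y ≡ f x y
guarded-< f {x} x<y = cong (f x) (m+[n∸m]≡n x<y)

module Computability (X : Set′) where

  Computable : (n : ℕ) → (Vec ℕ n → ℕ) → Set
  Computable n F = Σ (PR n) λ e → ∀ xs → Eval X e xs (F xs)

  ComputablePred : (n : ℕ) → (Vec ℕ n → Bool) → Set
  ComputablePred n P = Computable n (λ xs → b2n (P xs))

  computable-ext : ∀ {n F G} → (∀ xs → F xs ≡ G xs) → Computable n F → Computable n G
  computable-ext F≗G (e , ok) = e , λ xs → subst (Eval X e xs) (F≗G xs) (ok xs)

  zero-computable : ∀ {n} → Computable n (λ _ → 0)
  zero-computable = zer , λ _ → ev-zer

  suc-computable : Computable 1 (λ xs → suc (head xs))
  suc-computable = succ , λ { (x ∷ []) → ev-succ }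

  lookup-computable : ∀ {n} (i : Fin n) → Computable n (λ xs → lookup xs i)
  lookup-computable i = proj i , λ _ → ev-proj

  oracle-computable : ComputablePred 1 (λ xs → X (head xs))
  oracle-computable = oracle , λ { (x ∷ []) → ev-oracle }

  reindex : ∀ {m n G} (ρ : Fin m → Fin n) → Computable m G →
            Computable n (λ xs → G (tabulate (λ i → lookup xs (ρ i))))
  reindex {n = n} ρ (g , ok) =
    comp g (tabulate (λ i → proj (ρ i))) , λ xs → ev-comp (projections ρ xs) (ok _)
    where
    projections : ∀ {m} (ρ : Fin m → Fin n) xs →
                  EvalAll X xs (tabulate (λ i → proj (ρ i))) (tabulate (λ i → lookup xs (ρ i)))
    projections {zero}  ρ xs = []
    projections {suc m} ρ xs = ev-proj ∷ projections (λ i → ρ (suc i)) xs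

  compose₁ : ∀ {n G F} → Computable 1 G → Computable n F → Computable n (λ xs → G (F xs ∷ []))
  compose₁ (g , okg) (h , okh) = comp g (h ∷ []) , λ xs → ev-comp (okh xs ∷ []) (okg _)

  compose₂ : ∀ {n G F₀ F₁} → Computable 2 G → Computable n F₀ → Computable n F₁ →
             Computable n (λ xs → G (F₀ xs ∷ F₁ xs ∷ []))
  compose₂ (g , okg) (h₀ , ok₀) (h₁ , ok₁) =
    comp g (h₀ ∷ h₁ ∷ []) , λ xs → ev-comp (ok₀ xs ∷ ok₁ xs ∷ []) (okg _)

  primRec : ∀ {n G S} (F : Vec ℕ (suc n) → ℕ) → Computable n G → Computable (suc (suc n)) S →
            (∀ xs → F (0 ∷ xs) ≡ G xs) →
            (∀ k xs → F (suc k ∷ xs) ≡ S (k ∷ F (k ∷ xs) ∷ xs)) →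
            Computable (suc n) F
  primRec F (g , okg) (h , okh) F-zero F-suc = prec g h , ok
    where
    ok : ∀ xs → Eval X (prec g h) xs (F xs)
    ok (zero  ∷ xs) = subst (Eval X (prec g h) _) (sym (F-zero xs)) (ev-prec-z (okg xs))
    ok (suc k ∷ xs) = subst (Eval X (prec g h) _) (sym (F-suc k xs)) (ev-prec-s (ok (k ∷ xs)) (okh _))

  minimise : ∀ {n G} → Computable (suc n) G →
             (bound : Vec ℕ n → ℕ) → (∀ xs → G (bound xs ∷ xs) ≡ 0) →
             Computable n (λ xs → firstZero (λ y → G (y ∷ xs)) (bound xs))
  minimise {G = G} (g , ok) bound zero-at-bound = mu g , λ xs →
    ev-mu (subst (Eval X g _) (firstZero-zero (λ y → G (y ∷ xs)) (bound xs) (zero-at-bound xs)) (ok _))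
          (λ z z< → let (u , eq) = firstZero-before (λ y → G (y ∷ xs)) (bound xs) z z< in
                    u , subst (Eval X g _) eq (ok _))

  constᶜ : ∀ {n} c → Computable n (λ _ → c)
  constᶜ zero    = zero-computable
  constᶜ (suc c) = compose₁ suc-computable (constᶜ c)

  +-computable : Computable 2 (uncurry₂ _+_)
  +-computable = primRec (uncurry₂ _+_) (lookup-computable zero)
    (compose₁ suc-computable (lookup-computable (suc zero)))
    (λ { (y ∷ []) → refl }) (λ { k (y ∷ []) → refl })

  pred-computable : Computable 1 (λ xs → pred (head xs))
  pred-computable = primRec (λ xs → pred (head xs)) zero-computable (lookup-computable zero)
    (λ { [] → refl }) (λ { k [] → refl })

  ∸-computable : Computable 2 (uncurry₂ λ y x → x ∸ y)
  ∸-computable = primRec (uncurry₂ λ y x → x ∸ y) (lookup-computable zero)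
    (compose₁ pred-computable (lookup-computable (suc zero)))
    (λ { (x ∷ []) → refl }) (λ { k (x ∷ []) → sym (pred[m∸n]≡m∸[1+n] x k) })

  infixl 6 _+ᶜ_ _∸ᶜ_

  _+ᶜ_ : ∀ {n F G} → Computable n F → Computable n G → Computable n (λ xs → F xs + G xs)
  c +ᶜ d = compose₂ +-computable c d

  _∸ᶜ_ : ∀ {n F G} → Computable n F → Computable n G → Computable n (λ xs → F xs ∸ G xs)
  c ∸ᶜ d = compose₂ ∸-computable d c

  sgᶜ : ∀ {n F} → Computable n F → Computable n (λ xs → sg (F xs))
  sgᶜ c = constᶜ 1 ∸ᶜ (constᶜ 1 ∸ᶜ c)

  notᶜ : ∀ {n P} → ComputablePred n P → ComputablePred n (λ xs → not (P xs))
  notᶜ {P = P} c = computable-ext (λ xs → b2n-not (P xs)) (constᶜ 1 ∸ᶜ c)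

  _∧ᶜ_ : ∀ {n P Q} → ComputablePred n P → ComputablePred n Q → ComputablePred n (λ xs → P xs ∧ Q xs)
  _∧ᶜ_ {P = P} {Q} c d = computable-ext (λ xs → b2n-∧ (P xs) (Q xs)) (c +ᶜ d ∸ᶜ constᶜ 1)

  agrees-computable : ∀ {n P} c → ComputablePred n P → ComputablePred n (λ xs → agrees c (P xs))
  agrees-computable true  p = p
  agrees-computable false p = notᶜ p

  <ᵇ-computable : ∀ {n F G} → Computable n F → Computable n G → ComputablePred n (λ xs → F xs <ᵇ G xs)
  <ᵇ-computable {F = F} {G} c d = computable-ext (λ xs → b2n-<ᵇ (F xs) (G xs)) (sgᶜ (d ∸ᶜ c))

  index-computable : ∀ {n} i → Computable n (λ xs → index xs i)
  index-computable {zero}  i       = computable-ext (λ { [] → refl }) zero-computable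
  index-computable {suc n} zero    = computable-ext (λ { (x ∷ xs) → refl }) (lookup-computable zero)
  index-computable {suc n} (suc i) =
    computable-ext (λ { (x ∷ xs) → cong (λ ys → index ys i) (tabulate∘lookup xs) })
                   (reindex suc (index-computable i))

  coloring-computable : ∀ {f n F G} → ComputableColoring f → Computable n F → Computable n G →
                        ComputablePred n (λ xs → guarded f (F xs) (G xs))
  coloring-computable {F = F} (e , ok) (x , okx) c =
    comp (dropOracle e) (x ∷ proj₁ y ∷ []) ,
    λ xs → ev-comp (okx xs ∷ proj₂ y xs ∷ []) (dropOracle-eval (ok _ _ (s≤s (m≤m+n (F xs) _))))
    where
    x+1 = compose₁ suc-computable (x , okx)
    y = x+1 +ᶜ (c ∸ᶜ x+1)

  allBelow-computable : ∀ {n} k (Q : ℕ → Vec ℕ n → Bool) → (∀ i → ComputablePred n (Q i)) →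
                        ComputablePred n (λ xs → allBelow k (λ i → Q i xs))
  allBelow-computable zero    Q c = constᶜ 1
  allBelow-computable (suc k) Q c = allBelow-computable k Q c ∧ᶜ c k

  anyBelow-computable : ∀ {d Q} → ComputablePred (suc (suc d)) Q →
                        ComputablePred (suc d) (λ ctx → anyBelow (head ctx) (λ x → Q (x ∷ ctx)))
  anyBelow-computable {d} {Q} c =
    computable-ext (λ { (y ∷ ctx) → cong (λ ys → F (y ∷ ys)) (tabulate∘lookup (y ∷ ctx)) })
                   (reindex duplicate (primRec F zero-computable step (λ _ → refl) F-suc))
    where
    F : Vec ℕ (suc (suc d)) → ℕ
    F (y ∷ ctx) = b2n (anyBelow y (λ x → Q (x ∷ ctx)))

    skip : Fin (suc (suc d)) → Fin (suc (suc (suc d)))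
    skip zero    = zero
    skip (suc i) = suc (suc i)

    duplicate : Fin (suc (suc d)) → Fin (suc d)
    duplicate zero    = zero
    duplicate (suc i) = i

    step = sgᶜ (lookup-computable (suc zero) +ᶜ reindex skip c)

    F-suc : ∀ k ctx → F (suc k ∷ ctx) ≡ sg (F (k ∷ ctx) + b2n (Q (k ∷ tabulate (lookup ctx))))
    F-suc k ctx = begin
      b2n (anyBelow k Q′ ∨ Q′ k)
        ≡⟨ b2n-∨ (anyBelow k Q′) (Q′ k) ⟨
      sg (F (k ∷ ctx) + b2n (Q′ k))
        ≡⟨ cong (λ ys → sg (F (k ∷ ctx) + b2n (Q (k ∷ ys)))) (tabulate∘lookup ctx) ⟨
      sg (F (k ∷ ctx) + b2n (Q (k ∷ tabulate (lookup ctx)))) ∎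
      where
      open ≡-Reasoning
      Q′ = λ x → Q (x ∷ ctx)

  anyChainBelow-computable : ∀ k {d P} → ComputablePred (k ⊕ suc d) P →
                             ComputablePred (suc d) (anyChainBelow k P)
  anyChainBelow-computable zero    c = c
  anyChainBelow-computable (suc k) c = anyBelow-computable (anyChainBelow-computable k c)

  intervalCode-computable : Computable 2 (uncurry₂ intervalCode)
  intervalCode-computable = primRec (uncurry₂ intervalCode) (compose₁ ones-computable (lookup-computable zero))
    (double (lookup-computable (suc zero)))
    (λ { (len ∷ []) → refl }) (λ { lo (len ∷ []) → *-comm (intervalCode lo len) 2 })
    where
    double : ∀ {n F} → Computable n F → Computable n (λ xs → 2 * F xs)
    double c = c +ᶜ (c +ᶜ constᶜ 0)
    ones-computable : Computable 1 (λ xs → ones (head xs))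
    ones-computable = primRec (λ xs → ones (head xs)) zero-computable
      (compose₁ suc-computable (double (lookup-computable (suc zero))))
      (λ { [] → refl }) (λ { l [] → cong suc (*-comm (ones l) 2) })

colU-< : ∀ p {x y} → x < y → colU p x y ≡ col p x y
colU-< p x<y rewrite <ᵇ-true x<y = refl

colU-> : ∀ p {x y} → y < x → colU p x y ≡ col p y x
colU-> p y<x rewrite <ᵇ-false (<⇒≤ y<x) = refl

colU-sym : ∀ p {x y} → x ≢ y → colU p x y ≡ colU p y x
colU-sym p {x} {y} x≢y with <-cmp x y
... | tri< x<y _ _ = trans (colU-< p x<y) (sym (colU-> p x<y))
... | tri≈ _ x≡y _ = contradiction x≡y x≢y
... | tri> _ _ y<x = trans (colU-> p y<x) (sym (colU-< p y<x))

subPattern-colU : ∀ {q p} → ((g , _ , injective , colours) : SubPattern q p) →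
                  ∀ {x y} → x < len q → y < len q → x ≢ y → colU q x y ≡ colU p (g x) (g y)
subPattern-colU {q} {p} (g , _ , injective , colours) {x} {y} x<l y<l x≢y with <-cmp x y
... | tri< x<y _ _ = trans (colU-< q x<y) (colours x y x<y y<l)
... | tri≈ _ x≡y _ = contradiction x≡y x≢y
... | tri> _ _ y<x = trans (colU-> q y<x)
                      (trans (colours y x y<x x<l)
                             (colU-sym p (λ gy≡gx → x≢y (injective x y x<l y<l (sym gy≡gx)))))

subPattern-trans : ∀ {s q p} → SubPattern s q → SubPattern q p → SubPattern s p
subPattern-trans {s} (g , bounded , injective , colours) q⊑p@(h , bounded′ , injective′ , _) =
  (λ x → h (g x)) ,
  (λ x x<l → bounded′ (g x) (bounded x x<l)) ,
  (λ x y x<l y<l hgx≡hgy →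
     injective x y x<l y<l (injective′ (g x) (g y) (bounded x x<l) (bounded y y<l) hgx≡hgy)) ,
  λ x y x<y y<l → let x<l = <-trans x<y y<l in
    trans (colours x y x<y y<l)
          (subPattern-colU q⊑p (bounded x x<l) (bounded y y<l)
                           (λ gx≡gy → <⇒≢ x<y (injective x y x<l y<l gx≡gy)))

increasing⇒subPattern : ∀ {q p} (g : ℕ → ℕ) →
                        (∀ {x} → x < len q → g x < len p) → (∀ {x y} → x < y → g x < g y) →
                        (∀ {x y} → x < y → y < len q → col q x y ≡ col p (g x) (g y)) → SubPattern q p
increasing⇒subPattern {q} {p} g bounded increasing colours =
  g , (λ _ → bounded) , injective , λ x y x<y y<l → trans (colours x<y y<l) (sym (colU-< p (increasing x<y)))
  where
  injective : ∀ x y → x < len q → y < len q → g x ≡ g y → x ≡ y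
  injective x y _ _ gx≡gy with <-cmp x y
  ... | tri< x<y _ _ = contradiction gx≡gy (<⇒≢ (increasing x<y))
  ... | tri≈ _ x≡y _ = x≡y
  ... | tri> _ _ y<x = contradiction (sym gx≡gy) (<⇒≢ (increasing y<x))

prefix-subPattern : ∀ p {k} → k ≤ len p → SubPattern (pat k (col p)) p
prefix-subPattern p k≤l = increasing⇒subPattern id (λ x<k → <-≤-trans x<k k≤l) id (λ _ _ → refl)

≈P⇒subPattern : ∀ {p p′} → p ≈P p′ → SubPattern p′ p
≈P⇒subPattern (l≡l′ , colours) = increasing⇒subPattern id (λ x<l′ → subst (_ <_) (sym l≡l′) x<l′) id
  (λ x<y y<l′ → sym (colours _ _ x<y (subst (_ <_) (sym l≡l′) y<l′)))

join-col-left : ∀ q r {x y} → y < len q → col (join q r) x y ≡ col q x y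
join-col-left q r y<l rewrite <ᵇ-true y<l = refl

join-col-across : ∀ q r {x y} → x < len q ∸ 1 → len q ∸ 1 ≤ y →
                  col (join q r) x y ≡ col q x (len q ∸ 1)
join-col-across q@(pat (suc a) _) r {x} {y} x<a a≤y with m≤n⇒m<n∨m≡n a≤y
... | inj₂ refl = join-col-left q r (n<1+n a)
... | inj₁ a<y  rewrite <ᵇ-false a<y | ≤ᵇ-false x<a = refl

join-col-right : ∀ q r {x y} → 1 ≤ len q → len q ∸ 1 ≤ x → x < y →
                 col (join q r) x y ≡ col r (x ∸ (len q ∸ 1)) (y ∸ (len q ∸ 1))
join-col-right (pat (suc a) _) r _ a≤x x<y rewrite <ᵇ-false (≤-<-trans a≤x x<y) | ≤ᵇ-true a≤x = refl

join-subPatternˡ : ∀ q r → 1 ≤ len r → SubPattern q (join q r)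
join-subPatternˡ q r 1≤r = increasing⇒subPattern id (λ x<l → <-≤-trans x<l len-q≤) id
  (λ _ y<l → sym (join-col-left q r y<l))
  where
  len-q≤ : len q ≤ len q + len r ∸ 1
  len-q≤ = subst (len q ≤_) (sym (+-∸-assoc (len q) 1≤r)) (m≤m+n (len q) _)

join-subPatternʳ : ∀ q r → 1 ≤ len q → SubPattern r (join q r)
join-subPatternʳ q@(pat (suc a) _) r _ = increasing⇒subPattern (a +_) (+-monoʳ-< a) (+-monoʳ-< a)
  λ {x} {y} x<y _ → sym (trans (join-col-right q r (s≤s z≤n) (m≤m+n a x) (+-monoʳ-< a x<y))
                               (cong₂ (col r) (m+n∸m≡n a x) (m+n∸m≡n a y)))

join-len-left : ∀ q r → 1 ≤ len q → 2 ≤ len r → len q < len (join q r)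
join-len-left (pat (suc a) _) r _ 2≤r = subst (_≤ a + len r) (+-comm a 2) (+-monoʳ-≤ a 2≤r)

join-len-right : ∀ q r → 2 ≤ len q → len r < len (join q r)
join-len-right (pat (suc (suc a)) _) r _ = s≤s (m≤n+m (len r) a)
join-len-right (pat (suc zero) _) r (s≤s ())

HereditarilyConvergentOrReducible : Pattern → Set
HereditarilyConvergentOrReducible p = ∀ q → 1 ≤ len q → SubPattern q p → Convergent q ⊎ Reducible q

hereditary-subPattern : ∀ {p q} → HereditarilyConvergentOrReducible p → SubPattern q p →
                        HereditarilyConvergentOrReducible q
hereditary-subPattern hereditary q⊑p s 1≤s s⊑q = hereditary s 1≤s (subPattern-trans s⊑q q⊑p)

-- Strong appearance

module Realizations (H : Set′) (f : ℕ → ℕ → Bool) where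

  record Realization (m : ℕ) (Q : ℕ → ℕ → Bool) (t : ℕ) (zs : ℕ → ℕ) : Set where
    field
      inH-above  : ∀ i → i < m → H (zs i) ≡ true × t < zs i
      increasing : Increasing m zs
      colours    : ∀ i j → i < j → j < m → f (zs i) (zs j) ≡ Q i j

  StronglyAppearsAbove : Pattern → ℕ → Set
  StronglyAppearsAbove p t =
    ∃ λ xs → (∀ i → i < len p ∸ 1 → H (xs i) ≡ true × t < xs i) × StronglyRealizes f xs p

  stronglyAppearsAbove-singleton : ∀ {c t} → StronglyAppearsAbove (pat 1 c) t
  stronglyAppearsAbove-singleton = (λ _ → 0) , (λ _ ()) , (λ _ _ _ ()) , (λ _ _ _ ()) , (λ _ ())

  limits-eventually : ∀ {l c xs} → StronglyRealizes f xs (pat (suc l) c) →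
                      Eventually (λ y → ∀ i → i < l → xs i < y × f (xs i) y ≡ c i l)
  limits-eventually {l} {xs = xs} (_ , _ , limits) = eventually-all l λ i i<l →
    let (N , lim) = limits i i<l in
    N ⊔ xs i , λ y N⊔x<y → let x<y = ≤-<-trans (m≤n⊔m N (xs i)) N⊔x<y in
                            x<y , lim y (≤-<-trans (m≤m⊔n N (xs i)) N⊔x<y) x<y

  realization-extend : Infinite H → ∀ {l c t} → StronglyAppearsAbove (pat (suc l) c) t →
                       ∃ (Realization (suc l) c t)
  realization-extend infinite {l} {c} {t} (xs , inH-above , increasing , colours , limits) = zs , record
    { inH-above  = extended {λ z → H z ≡ true × t < z} inH-above (y∈H , t<y)
    ; increasing = increasing′
    ; colours    = colours′
    }
    where
    N = proj₁ (limits-eventually (increasing , colours , limits))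
    y = proj₁ (infinite (suc (N ⊔ t)))
    N⊔t<y = proj₁ (proj₂ (infinite (suc (N ⊔ t))))
    y∈H   = proj₂ (proj₂ (infinite (suc (N ⊔ t))))
    t<y   = ≤-<-trans (m≤n⊔m N t) N⊔t<y
    at-y  = proj₂ (limits-eventually (increasing , colours , limits)) y (≤-<-trans (m≤m⊔n N t) N⊔t<y)
    zs = splice l xs (λ _ → y)
    zs-< : ∀ {i} → i < l → zs i ≡ xs i
    zs-< = splice-< l xs (λ _ → y)
    zs-l : zs l ≡ y
    zs-l = splice-≥ l xs (λ _ → y) ≤-refl
    extended : ∀ {P : ℕ → Set} → (∀ i → i < l → P (xs i)) → P y → ∀ i → i < suc l → P (zs i)
    extended {P} Pxs Py i i<1+l with m<1+n⇒m<n∨m≡n i<1+l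
    ... | inj₁ i<l  = subst P (sym (zs-< i<l)) (Pxs i i<l)
    ... | inj₂ refl = subst P (sym zs-l) Py
    increasing′ : Increasing (suc l) zs
    increasing′ i (s≤s 1+i≤l) rewrite zs-< 1+i≤l with m≤n⇒m<n∨m≡n 1+i≤l
    ... | inj₁ 1+i<l rewrite zs-< 1+i<l = increasing i (suc i) (n<1+n i) 1+i<l
    ... | inj₂ refl  rewrite zs-l = proj₁ (at-y i (n<1+n i))
    colours′ : ∀ i j → i < j → j < suc l → f (zs i) (zs j) ≡ c i j
    colours′ i j i<j j<1+l with m<1+n⇒m<n∨m≡n j<1+l
    ... | inj₁ j<l  rewrite zs-< (<-trans i<j j<l) | zs-< j<l = colours i j i<j j<l
    ... | inj₂ refl rewrite zs-< i<j | zs-l = proj₂ (at-y i i<j)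

  Realization-≤ : ∀ {m Q t t′ zs} → t′ ≤ t → Realization m Q t zs → Realization m Q t′ zs
  Realization-≤ t′≤t r = record
    { inH-above  = λ i i<m → let (z∈H , t<z) = inH-above i i<m in z∈H , ≤-<-trans t′≤t t<z
    ; increasing = increasing
    ; colours    = colours
    }
    where open Realization r

  module Search (f-computable : ComputableColoring f) (m : ℕ) (Q : ℕ → ℕ → Bool) where
    open Computability H

    -- The context is z₀ ∷ … ∷ z_{m-1} ∷ b ∷ t ∷ [].
    memberᵇ : Vec ℕ (m ⊕ 2) → ℕ → Bool
    memberᵇ v i = H (index v i) ∧ (index v (m + 1) <ᵇ index v i)

    colourᵇ : Vec ℕ (m ⊕ 2) → ℕ → ℕ → Bool
    colourᵇ v i j = agrees (Q i j) (guarded f (index v i) (index v j))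

    realizesᵇ : Vec ℕ (m ⊕ 2) → Bool
    realizesᵇ v = allBelow m (memberᵇ v) ∧ allBelow m (λ j → allBelow j (λ i → colourᵇ v i j))

    realizesᵇ-computable : ComputablePred (m ⊕ 2) realizesᵇ
    realizesᵇ-computable =
      allBelow-computable m _ (λ i → compose₁ oracle-computable (index-computable i)
                                     ∧ᶜ <ᵇ-computable (index-computable (m + 1)) (index-computable i))
      ∧ᶜ allBelow-computable m _ (λ j → allBelow-computable j _ (λ i →
           agrees-computable (Q i j) (coloring-computable f-computable (index-computable i) (index-computable j))))

    module _ (zs : ℕ → ℕ) (b t : ℕ) where
      private
        v = prepend m zs (b ∷ t ∷ [])
        v-< : ∀ {i} → i < m → index v i ≡ zs i
        v-< = index-prepend-< m zs (b ∷ t ∷ [])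
        v-t : index v (m + 1) ≡ t
        v-t = index-prepend-≥ m zs (b ∷ t ∷ []) 1

      realizesᵇ-sound : ChainBelow m zs b → realizesᵇ v ≡ true → Realization m Q t zs
      realizesᵇ-sound (increasing , _) found = record
        { inH-above  = inH-above
        ; increasing = increasing
        ; colours    = colours
        }
        where
        membersᵇ = proj₁ (∧≡true⁻ found)
        coloursᵇ = proj₂ (∧≡true⁻ found)
        inH-above : ∀ i → i < m → H (zs i) ≡ true × t < zs i
        inH-above i i<m =
          let (z∈H , t<z) = ∧≡true⁻ (allBelow-elim m (memberᵇ v) membersᵇ i i<m) in
          subst (λ z → H z ≡ true) (v-< i<m) z∈H , subst₂ _<_ v-t (v-< i<m) (<ᵇ≡true⇒< t<z)
        colours : ∀ i j → i < j → j < m → f (zs i) (zs j) ≡ Q i j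
        colours i j i<j j<m =
          let agree = allBelow-elim j (λ i → colourᵇ v i j) (allBelow-elim m _ coloursᵇ j j<m) i i<j in
          trans (sym (guarded-< f (Increasing⇒< increasing i<j j<m)))
                (agrees⇒≡ (Q i j) _ (subst₂ (λ x y → agrees (Q i j) (guarded f x y) ≡ true)
                                             (v-< (<-trans i<j j<m)) (v-< j<m) agree))

      realizesᵇ-complete : Realization m Q t zs → realizesᵇ v ≡ true
      realizesᵇ-complete r = cong₂ _∧_
        (allBelow-intro m (memberᵇ v) λ i i<m → let (z∈H , t<z) = inH-above i i<m in
           subst₂ (λ s z → H z ∧ (s <ᵇ z) ≡ true) (sym v-t) (sym (v-< i<m))
                  (cong₂ _∧_ z∈H (<ᵇ-true t<z)))
        (allBelow-intro m _ λ j j<m → allBelow-intro j (λ i → colourᵇ v i j) λ i i<j →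
           subst₂ (λ x y → agrees (Q i j) (guarded f x y) ≡ true) (sym (v-< (<-trans i<j j<m))) (sym (v-< j<m))
                  (subst (λ c → agrees (Q i j) c ≡ true)
                         (sym (trans (guarded-< f (Increasing⇒< increasing i<j j<m)) (colours i j i<j j<m)))
                         (agrees-refl (Q i j))))
        where open Realization r

    realizationBelowᵇ : Vec ℕ 2 → Bool
    realizationBelowᵇ = anyChainBelow m realizesᵇ

    module _ (realizations : ∀ t → ∃ (Realization m Q t)) where

      noneBelow : Vec ℕ 2 → ℕ
      noneBelow ctx = b2n (not (realizationBelowᵇ ctx))

      someBound : Vec ℕ 1 → ℕ
      someBound (t ∷ []) = proj₁ (Increasing⇒ChainBelow (Realization.increasing (proj₂ (realizations t))))

      noneBelow-someBound : ∀ xs → noneBelow (someBound xs ∷ xs) ≡ 0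
      noneBelow-someBound (t ∷ []) = cong (λ found → b2n (not found))
        (anyChainBelow-intro m realizesᵇ (b ∷ t ∷ []) zs chain (realizesᵇ-complete zs b t r))
        where
        zs = proj₁ (realizations t)
        r = proj₂ (realizations t)
        b = proj₁ (Increasing⇒ChainBelow (Realization.increasing r))
        chain = proj₂ (Increasing⇒ChainBelow (Realization.increasing r))

      searchBound : ℕ → ℕ
      searchBound t = firstZero (λ b → noneBelow (b ∷ t ∷ [])) (someBound (t ∷ []))

      searchBound-computable : Computable 1 (λ xs → searchBound (head xs))
      searchBound-computable = computable-ext (λ { (t ∷ []) → refl })
        (minimise (notᶜ (anyChainBelow-computable m realizesᵇ-computable)) someBound noneBelow-someBound)

      realization-belowSearchBound : ∀ t → ∃ λ zs → ChainBelow m zs (searchBound t) × Realization m Q t zs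
      realization-belowSearchBound t =
        let (zs , chain , found) = anyChainBelow-elim m realizesᵇ (searchBound t ∷ t ∷ [])
              (b2n-not≡0 (firstZero-zero (λ b → noneBelow (b ∷ t ∷ [])) (someBound (t ∷ []))
                                         (noneBelow-someBound (t ∷ []))))
        in zs , chain , realizesᵇ-sound zs (searchBound t) t chain found

      module _ (B : Set′) (B-hyperimmune : Hyperimmune H B) (0<m : 0 < m) (n₀ : ℕ) where

        -- The k-th guess is an interval above k + n₀ that contains a realization of Q.
        intervalGuess : ℕ → ℕ
        intervalGuess k = intervalCode (suc (k + n₀)) (searchBound (k + n₀) ∸ suc (k + n₀))

        intervalGuess-computable : Computable₁ H intervalGuess
        intervalGuess-computable = proj₁ guess , λ k → proj₂ guess (k ∷ [])
          where
          t = lookup-computable zero +ᶜ constᶜ n₀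
          1+t = compose₁ suc-computable t
          guess = compose₂ intervalCode-computable 1+t (compose₁ searchBound-computable t ∸ᶜ 1+t)

        realization-inGuess : ∀ k i → i < m →
                              proj₁ (realization-belowSearchBound (k + n₀)) i ∈D intervalGuess k
        realization-inGuess k i i<m = ∈-intervalCode (suc (k + n₀)) _ t<z
          (subst (z <_) (sym (m+[n∸m]≡n (≤-trans t<z (<⇒≤ z<b)))) z<b)
          where
          found = proj₂ (realization-belowSearchBound (k + n₀))
          z = proj₁ (realization-belowSearchBound (k + n₀)) i
          t<z = proj₂ (Realization.inH-above (proj₂ found) i i<m)
          z<b = ChainBelow⇒< (proj₁ found) i<m

        intervalGuess-min : ∀ k i → i ∈D intervalGuess k → k < i
        intervalGuess-min k i i∈ = ≤-trans (s≤s (m≤m+n k n₀)) (intervalCode-min (suc (k + n₀)) _ i∈)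

        realization-avoiding : ∃ λ zs → Realization m Q n₀ zs × (∀ i → i < m → B (zs i) ≡ false)
        realization-avoiding =
          let (k , disjoint) = proj₂ B-hyperimmune intervalGuess intervalGuess-computable
                (λ k → proj₁ (realization-belowSearchBound (k + n₀)) 0 , realization-inGuess k 0 0<m)
                intervalGuess-min
              (zs , _ , r) = realization-belowSearchBound (k + n₀)
          in zs , Realization-≤ (m≤n+m n₀ k) r , λ i i<m → disjoint _ (realization-inGuess k i i<m)

  stronglyAppearsAbove-≈P : ∀ {p p′ t} → p ≈P p′ → StronglyAppearsAbove p′ t → StronglyAppearsAbove p t
  stronglyAppearsAbove-≈P {pat l c} (refl , same) (xs , inH-above , increasing , colours , limits) =
    xs , inH-above , increasing ,
    (λ i j i<j j<l → trans (colours i j i<j j<l) (sym (same i j i<j (<-trans j<l (∸1<  j<l))))) ,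
    λ i i<l → let (N , lim) = limits i i<l in
      N , λ y N<y x<y → trans (lim y N<y x<y) (sym (same i (l ∸ 1) i<l (∸1< i<l)))
    where
    ∸1< : ∀ {i l} → i < l ∸ 1 → l ∸ 1 < l
    ∸1< {l = suc l} _ = n<1+n l

  -- The r-part lies beyond K, where every element of the q-part has settled on its limit colour.
  module Concatenation (a s : ℕ) (cq cr : ℕ → ℕ → Bool) (t : ℕ)
                       (q-above : StronglyAppearsAbove (pat (suc a) cq) t)
                       (r-above : ∀ t → StronglyAppearsAbove (pat (suc (suc s)) cr) t) where
    private
      q = pat (suc a) cq
      r = pat (suc (suc s)) cr
      xs₁ = proj₁ q-above
      inH-above₁ = proj₁ (proj₂ q-above)
      increasing₁ = proj₁ (proj₂ (proj₂ q-above))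
      colours₁ = proj₁ (proj₂ (proj₂ (proj₂ q-above)))
      K = proj₁ (limits-eventually (proj₂ (proj₂ q-above)))
      beyond-K = proj₂ (limits-eventually (proj₂ (proj₂ q-above)))
      r-part = r-above (K ⊔ t)
      xs₂ = proj₁ r-part
      inH-above₂ = proj₁ (proj₂ r-part)
      increasing₂ = proj₁ (proj₂ (proj₂ r-part))
      colours₂ = proj₁ (proj₂ (proj₂ (proj₂ r-part)))
      limits₂ = proj₂ (proj₂ (proj₂ (proj₂ r-part)))

    xs : ℕ → ℕ
    xs = splice a xs₁ (λ i → xs₂ (i ∸ a))

    private
      xs-< : ∀ {i} → i < a → xs i ≡ xs₁ i
      xs-< = splice-< a xs₁ (λ i → xs₂ (i ∸ a))
      xs-≥ : ∀ {i} → a ≤ i → xs i ≡ xs₂ (i ∸ a)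
      xs-≥ = splice-≥ a xs₁ (λ i → xs₂ (i ∸ a))
      ∸a< : ∀ {i} → a ≤ i → i < a + suc s → i ∸ a < suc s
      ∸a< {i} a≤i i<a+s = subst (i ∸ a <_) (m+n∸m≡n a (suc s)) (∸-monoˡ-< i<a+s a≤i)
      K<xs₂ : ∀ {j} → a ≤ j → j < a + suc s → K < xs₂ (j ∸ a)
      K<xs₂ a≤j j< = ≤-<-trans (m≤m⊔n K t) (proj₂ (inH-above₂ _ (∸a< a≤j j<)))
      across : ∀ {i j} → i < a → a ≤ j → j < a + suc s →
               xs₁ i < xs₂ (j ∸ a) × f (xs₁ i) (xs₂ (j ∸ a)) ≡ cq i a
      across i<a a≤j j< = beyond-K _ (K<xs₂ a≤j j<) _ i<a

    inH-above : ∀ i → i < a + suc s → H (xs i) ≡ true × t < xs i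
    inH-above i i< with i <? a
    ... | yes i<a rewrite xs-< i<a = inH-above₁ i i<a
    ... | no  i≮a rewrite xs-≥ (≮⇒≥ i≮a) =
      let (z∈H , K⊔t<z) = inH-above₂ _ (∸a< (≮⇒≥ i≮a) i<) in
      z∈H , ≤-<-trans (m≤n⊔m K t) K⊔t<z

    increasing : ∀ i j → i < j → j < a + suc s → xs i < xs j
    increasing i j i<j j< with j <? a | i <? a
    ... | yes j<a | _ rewrite xs-< (<-trans i<j j<a) | xs-< j<a = increasing₁ i j i<j j<a
    ... | no  j≮a | yes i<a rewrite xs-< i<a | xs-≥ (≮⇒≥ j≮a) = proj₁ (across i<a (≮⇒≥ j≮a) j<)
    ... | no  j≮a | no  i≮a rewrite xs-≥ (≮⇒≥ i≮a) | xs-≥ (≮⇒≥ j≮a) =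
      increasing₂ _ _ (∸-monoˡ-< i<j (≮⇒≥ i≮a)) (∸a< (≮⇒≥ j≮a) j<)

    colours : ∀ i j → i < j → j < a + suc s → f (xs i) (xs j) ≡ col (join q r) i j
    colours i j i<j j< with j <? a | i <? a
    ... | yes j<a | _ rewrite xs-< (<-trans i<j j<a) | xs-< j<a =
      trans (colours₁ i j i<j j<a) (sym (join-col-left q r (m<n⇒m<1+n j<a)))
    ... | no  j≮a | yes i<a rewrite xs-< i<a | xs-≥ (≮⇒≥ j≮a) =
      trans (proj₂ (across i<a (≮⇒≥ j≮a) j<)) (sym (join-col-across q r i<a (≮⇒≥ j≮a)))
    ... | no  j≮a | no  i≮a rewrite xs-≥ (≮⇒≥ i≮a) | xs-≥ (≮⇒≥ j≮a) =
      trans (colours₂ _ _ (∸-monoˡ-< i<j (≮⇒≥ i≮a)) (∸a< (≮⇒≥ j≮a) j<))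
            (sym (join-col-right q r (s≤s z≤n) (≮⇒≥ i≮a) i<j))

    limits : ∀ i → i < a + suc s →
             Eventually (λ y → xs i < y → f (xs i) y ≡ col (join q r) i (a + suc s))
    limits i i< with i <? a
    ... | yes i<a rewrite xs-< i<a =
      K , λ y K<y _ → trans (proj₂ (beyond-K y K<y i i<a)) (sym (join-col-across q r i<a (m≤m+n a (suc s))))
    ... | no  i≮a rewrite xs-≥ (≮⇒≥ i≮a) =
      let (N , lim) = limits₂ _ (∸a< (≮⇒≥ i≮a) i<) in
      N , λ y N<y x<y → trans (lim y N<y x<y)
        (sym (trans (join-col-right q r (s≤s z≤n) (≮⇒≥ i≮a) i<)
                    (cong (cr (i ∸ a)) (m+n∸m≡n a (suc s)))))

  join-stronglyAppearsAbove : ∀ q r → 1 ≤ len q → 2 ≤ len r →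
                              (∀ t → StronglyAppearsAbove q t) → (∀ t → StronglyAppearsAbove r t) →
                              ∀ t → StronglyAppearsAbove (join q r) t
  join-stronglyAppearsAbove q@(pat (suc a) cq) r@(pat (suc (suc s)) cr) _ _ q-above r-above t =
    subst (λ l → StronglyAppearsAbove (pat (suc l) (col (join q r))) t) (sym length)
      (xs , inH-above , increasing , colours , limits)
    where
    open Concatenation a s cq cr t (q-above t) r-above
    length : len (join q r) ∸ 1 ≡ a + suc s
    length = cong (_∸ 1) (+-suc a (suc s))
  join-stronglyAppearsAbove (pat (suc _) _) (pat (suc zero) _) _ (s≤s ())

  module _ (f-computable : ComputableColoring f) (infinite : Infinite H)
           (A : Set′) (approximates : Approximates f A)
           (A-hyperimmune : Hyperimmune H A) (Ā-hyperimmune : Hyperimmune H (complement A)) where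

    realization-coloured : ∀ {m Q} → 0 < m → (∀ t → ∃ (Realization m Q t)) → ∀ b t →
                           ∃ λ zs → Realization m Q t zs × (∀ i → i < m → A (zs i) ≡ b)
    realization-coloured 0<m realizations true t =
      let (zs , r , avoids) = Search.realization-avoiding f-computable _ _ realizations
                                (complement A) Ā-hyperimmune 0<m t
      in zs , r , λ i i<m → not-injective (avoids i i<m)
    realization-coloured 0<m realizations false t =
      Search.realization-avoiding f-computable _ _ realizations A A-hyperimmune 0<m t

    -- Taking every element with A-colour c 0 (l + 1) makes that its limit colour.
    convergent-step : ∀ l c → (∀ i → i < suc l → c i (suc l) ≡ c 0 (suc l)) →
                      (∀ t → StronglyAppearsAbove (pat (suc l) c) t) →
                      ∀ t → StronglyAppearsAbove (pat (suc (suc l)) c) t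
    convergent-step l c convergent prefix t =
      let (zs , r , coloured) =
            realization-coloured z<s (λ t → realization-extend infinite (prefix t)) (c 0 (suc l)) t
          open Realization r
      in zs , inH-above , (λ i j i<j j<m → Increasing⇒< increasing i<j j<m) , colours ,
         λ i i<m → let (N , lim) = approximates (zs i) in
           N , λ y N<y z<y → trans (lim y N<y z<y) (trans (coloured i i<m) (sym (convergent i i<m)))

    stronglyAppearsAbove : ∀ p → HereditarilyConvergentOrReducible p → ∀ t → StronglyAppearsAbove p t
    stronglyAppearsAbove = All.wfRec (On.wellFounded len <-wellFounded) _ _ step
      where
      step : ∀ p →
             (∀ {q} → len q < len p → HereditarilyConvergentOrReducible q → ∀ t → StronglyAppearsAbove q t) →
             HereditarilyConvergentOrReducible p → ∀ t → StronglyAppearsAbove p t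
      step (pat zero       _) _ _ _ = stronglyAppearsAbove-singleton
      step (pat (suc zero) _) _ _ _ = stronglyAppearsAbove-singleton
      step p@(pat (suc (suc l)) c) ih hereditary with hereditary p (s≤s z≤n) (prefix-subPattern p ≤-refl)
      ... | inj₁ convergent =
        convergent-step l c (λ i i<l → convergent i 0 i<l z<s)
          (ih (n<1+n _) (hereditary-subPattern hereditary (prefix-subPattern p (n≤1+n _))))
      ... | inj₂ (q , r , 2≤q , 2≤r , p≈q⊎r) = λ t →
        stronglyAppearsAbove-≈P p≈q⊎r
          (join-stronglyAppearsAbove q r 1≤q 2≤r
             (ih {q} (shorter q (join-len-left q r 1≤q 2≤r)) (part (join-subPatternˡ q r 1≤r)))
             (ih {r} (shorter r (join-len-right q r 2≤q)) (part (join-subPatternʳ q r 1≤q)))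
             t)
        where
        1≤q = ≤-trans (s≤s z≤n) 2≤q
        1≤r = ≤-trans (s≤s z≤n) 2≤r
        shorter : ∀ s → len s < len (join q r) → len s < len p
        shorter s = subst (len s <_) (sym (proj₁ p≈q⊎r))
        part : ∀ {s} → SubPattern s (join q r) → HereditarilyConvergentOrReducible s
        part s⊑q⊎r = hereditary-subPattern hereditary (subPattern-trans s⊑q⊎r (≈P⇒subPattern p≈q⊎r))

open Realizations

theorem4p17 : (p : Pattern) → 2 ≤ len p →
    (∀ q → 1 ≤ len q → SubPattern q p → Convergent q ⊎ Reducible q) →
    (A : ℕ → Bool) → Hyperimmune ∅ A → Hyperimmune ∅ (complement A) →
    (f : ℕ → ℕ → Bool) → ComputableColoring f → Approximates f A →
    (H : ℕ → Bool) → Infinite H →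
    Hyperimmune H A → Hyperimmune H (complement A) →
    StronglyAppears f p H
theorem4p17 p _ hereditary A _ _ f f-computable approximates H infinite A-hyperimmune Ā-hyperimmune =
  let (xs , inH-above , realizes) = stronglyAppearsAbove H f f-computable infinite A approximates
                                      A-hyperimmune Ā-hyperimmune p hereditary 0
  in xs , (λ i i<l → proj₁ (inH-above i i<l)) , realizes
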